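{- Let $n\ge 1$, $1\le k\le n$ and $0\le p\le n$ (with all quantities below taken to be $0$ at negative indices $p$). If $n$ is even, or if $n$ is odd and $2\le k\le n$, then $$\delta(n,k,p)=\delta(n,k,n-k+1-p)\quad\text{and}\quad\bar\delta(n,k,p)=\bar\delta(n,k,n-k+1-p).$$ If $n$ is odd and $k=1$, then $$\delta(n,1,p)=\bar\delta(n,1,n-p)\quad\text{and}\quad\bar\delta(n,1,p)=\delta(n,1,n-p).$$
   Context: $B_n$ is the set of signed permutations of $[n]$ (bijections $\pi$ of $\{\pm1,\dots,\pm n\}$ with $\pi(-i)=-\pi(i)$), with $\pi(0)=0$; $\mathrm{des}_k^B(\pi)=|\{0\le i\le n-k:\pi(i)>\pi(i+k)\}|$. $D_n$ is the set of $\pi\in B_n$ with an even number of negative entries among $\pi(1),\dots,\pi(n)$, and $\bar D_n=B_n\setminus D_n$. Let $d(n,k,p)=|\{\pi\in D_n:\mathrm{des}_k^B(\pi)=p\}|$ and $\bar d(n,k,p)=|\{\pi\in\bar D_n:\mathrm{des}_k^B(\pi)=p\}|$. Write $n=dk+r$, $0\le r<k$, and $M_{n,k}=n!/(((d+1)!)^r(d!)^{k-r})$. For $k=1$: $\delta(n,1,p)=d(n,1,p)$ and $\bar\delta(n,1,p)=\bar d(n,1,p)$. For $2\le k\le n$: $\delta(n,k,p)=d(n,k,p)/(2^{n-d-1}M_{n,k})$ and $\bar\delta(n,k,p)=\bar d(n,k,p)/(2^{n-d-1}M_{n,k})$ (so $\delta(n,k,p)$ is the coefficient of $x^p$ in $B_d(x)A_d(x)^{k-r-1}A_{d+1}(x)^r$,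 where $A_m,B_m$ are the type $A$ and type $B$ Eulerian polynomials). -}

module Defs where

open import Data.Bool using (Bool; true; false; _∧_; not; if_then_else_)
open import Data.Nat as ℕ using (ℕ; zero; suc; _+_; _*_; _∸_; _^_; _%_; _≡ᵇ_; NonZero; _!)
open import Data.Nat.Properties using (m^n≢0; m*n≢0; _!≢0)
open import Data.Bool.ListAction using (any)
open import Data.Integer as ℤ using (ℤ; +_; -[1+_]; ∣_∣)
open import Data.List using (List; []; _∷_; _++_; map; concatMap; upTo; length; filterᵇ; zip; drop)
open import Data.Product using (_,_; _×_)
open import Data.Rational as ℚ using (ℚ)

signedVals : ℕ → List ℤ
signedVals n = map (λ i → -[1+ i ]) (upTo n) ++ map (λ i → + suc i) (upTo n)

words : ℕ → ℕ → List (List ℤ)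
words n zero      = [] ∷ []
words n (suc len) = concatMap (λ v → map (v ∷_) (words n len)) (signedVals n)

distinctᵇ : List ℕ → Bool
distinctᵇ []       = true
distinctᵇ (x ∷ xs) = not (any (x ≡ᵇ_) xs) ∧ distinctᵇ xs

-- A signed permutation π ∈ B_n is represented by its window [π(1),…,π(n)]:
-- a word of length n over {±1,…,±n} whose absolute values are distinct
-- (hence form a permutation of [n]).
isSignedPerm : List ℤ → Bool
isSignedPerm w = distinctᵇ (map ∣_∣ w)

Bn : ℕ → List (List ℤ)
Bn n = filterᵇ isSignedPerm (words n n)

countᵇ : {A : Set} → (A → Bool) → List A → ℕ
countᵇ p xs = length (filterᵇ p xs)

-- des^B_k(π) = |{0 ≤ i ≤ n-k : π(i) > π(i+k)}| with π(0) = 0.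
-- With l = [π(0),π(1),…,π(n)], zip l (drop k l) lists the pairs (π(i),π(i+k)), 0 ≤ i ≤ n-k.
desB : ℕ → List ℤ → ℕ
desB k w = countᵇ (λ { (a , b) → not (a ℤ.≤ᵇ b) }) (zip l (drop k l))
  where l = + 0 ∷ w

negs : List ℤ → ℕ
negs w = countᵇ (λ x → not (+ 0 ℤ.≤ᵇ x)) w

isEven : ℕ → Bool
isEven m = (m % 2) ≡ᵇ 0

inD : List ℤ → Bool
inD w = isEven (negs w)

dcount : ℕ → ℕ → ℕ → ℕ
dcount n k p = countᵇ (λ w → inD w ∧ (desB k w ≡ᵇ p)) (Bn n)

dbarcount : ℕ → ℕ → ℕ → ℕ
dbarcount n k p = countᵇ (λ w → not (inD w) ∧ (desB k w ≡ᵇ p)) (Bn n)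

-- n = dk + r with 0 ≤ r < k (for k ≥ 1);  M_{n,k} = n! / (((d+1)!)^r (d!)^(k-r)).
-- M_{n,k} is represented by numerator and denominator.
Mnum : ℕ → ℕ → ℕ
Mnum n k = n !

Mden : ℕ → ℕ → ℕ
Mden n zero    = 1   -- unused (k ≥ 1 throughout)
Mden n (suc k) = (suc q !) ^ r * (q !) ^ (suc k ∸ r)
  where q = n ℕ./ suc k
        r = n % suc k

-- Normalisation: for k = 1 the identity, for k ≥ 2 division by 2^{n-d-1} M_{n,k},
-- i.e. c / (2^{n-d-1} · n!/Mden) = c · Mden / (2^{n-d-1} · n!), computed in ℚ.
normalise : ℕ → ℕ → ℕ → ℚ
normalise n zero          c = + c ℚ./ 1        -- unused (k ≥ 1)
normalise n (suc zero)    c = + c ℚ./ 1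
normalise n (suc (suc k)) c =
  ((+ (c * Mden n (suc (suc k)))) ℚ./ (2 ^ e * Mnum n (suc (suc k))))
    {{m*n≢0 (2 ^ e) (n !) {{m^n≢0 2 e}} {{n !≢0}}}}
  where
    e = n ∸ (n ℕ./ suc (suc k)) ∸ 1

δ : ℕ → ℕ → ℤ → ℚ
δ n k (+ p)    = normalise n k (dcount n k p)
δ n k -[1+ _ ] = ℚ.0ℚ

δ̄ : ℕ → ℕ → ℤ → ℚ
δ̄ n k (+ p)    = normalise n k (dbarcount n k p)
δ̄ n k -[1+ _ ] = ℚ.0ℚ

-- Negation π ↦ -π is an involution of B_n that reverses every comparison of π(i) with π(i + k)
-- (absolute values are distinct, including π(0) = 0), so des_k(-π) = n - k + 1 - des_k(π); it turns
-- m negative entries into n - m, so it keeps the classes D_n and D̄_n when n is even and swaps them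
-- when n is odd.  For n odd and k ≥ 2 a second involution swaps the classes back without changing
-- des_k: negate the entry of least absolute value among the positions i ≡ 1 (mod k).  Its
-- neighbours at distance k lie in the same residue class and have larger absolute value, and a
-- comparison of two integers of different absolute values depends only on the sign of the larger.

module Submission where

module DescentSymmetries where

  open import Defs
  open import Data.Bool using (Bool; true; false; _∧_; not; _xor_; if_then_else_; T)
  open import Data.Bool.Properties
    using (T-≡; T-∧; T-not-≡; not-involutive; ∧-zeroʳ; xor-assoc; xor-comm; xor-same; xor-identityʳ;
           not-distribˡ-xor; not-distribʳ-xor)
  open import Data.Empty using (⊥-elim)
  open import Data.Integer as ℤ using (ℤ; +_; -[1+_]; ∣_∣; -_) renaming (_+_ to _+ℤ_; _-_ to _-ℤ_)
  import Data.Integer.Properties as ℤ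
  open import Data.List
    using (List; []; _∷_; _++_; map; length; filterᵇ; upTo; concatMap; cartesianProductWith; zip; drop)
  open import Data.List.Extrema.Nat using (min; min≤xs; argmin-sel)
  open import Data.List.Membership.Propositional using (_∈_)
  open import Data.List.Membership.Propositional.Properties
    using (∈-map⁻; ∈-map⁺; ∈-++⁻; ∈-++⁺ˡ; ∈-++⁺ʳ; ∈-upTo⁺; ∈-upTo⁻; ∈-filter⁺; ∈-filter⁻;
           ∈-cartesianProductWith⁺; ∈-cartesianProductWith⁻)
  open import Data.List.Membership.Propositional.Properties.WithK using (unique∧set⇒bag)
  import Data.List.Properties as List
  open import Data.List.Relation.Binary.BagAndSetEquality using (∼bag⇒↭)
  open import Data.List.Relation.Binary.Permutation.Propositional using (_↭_; ↭-sym)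
  open import Data.List.Relation.Binary.Permutation.Propositional.Properties using (↭-length; filter-↭)
  open import Data.List.Relation.Unary.All as All using (All; []; _∷_)
  import Data.List.Relation.Unary.All.Properties as AllP
  open import Data.List.Relation.Unary.Any as Any using (here; there)
  open import Data.List.Relation.Unary.Any.Properties using (any⁺)
  open import Data.List.Relation.Unary.Unique.Propositional using (Unique; []; _∷_)
  import Data.List.Relation.Unary.Unique.Propositional.Properties as Unique
  open import Data.Nat using (ℕ; zero; suc; _+_; _*_; _∸_; _^_; _!; _≤_; _<_; _≡ᵇ_; _%_)
  import Data.Nat as ℕ
  import Data.Nat.Properties as ℕ
  open import Data.Nat.Properties using (_!≢0; +-identityʳ; ≡ᵇ⇒≡; ≡⇒≡ᵇ; +-suc; +-comm; suc-injective; 1+n≢0)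
  open import Data.Nat.DivMod using ([m+n]%n≡m%n)
  open import Data.Nat.Tactic.RingSolver using (solve-∀)
  open import Data.Product as Product using (_,_; _×_; proj₁; proj₂; ∃-syntax)
  open import Data.Rational using (ℚ; 0ℚ)
  import Data.Rational.Properties as ℚ
  open import Data.Sum using (_⊎_; inj₁; inj₂)
  open import Function using (_∘_; id)
  open import Function.Bundles using (mk⇔; Equivalence)
  open import Relation.Binary.PropositionalEquality
  open import Relation.Nullary using (¬_; yes; no)
  open import Relation.Nullary.Decidable using (T?)

  T-injective : ∀ {x y : Bool} → (T x → T y) → (T y → T x) → x ≡ y
  T-injective {false} {false} _ _ = refl
  T-injective {false} {true}  _ g = ⊥-elim (g _)
  T-injective {true}  {false} f _ = ⊥-elim (f _)
  T-injective {true}  {true}  _ _ = refl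

  T-≡true : ∀ {x} → x ≡ true → T x
  T-≡true = Equivalence.from T-≡

  ≡ᵇ-true⇒≡ : ∀ {m n} → (m ≡ᵇ n) ≡ true → m ≡ n
  ≡ᵇ-true⇒≡ {m} {n} m≡ᵇn = ≡ᵇ⇒≡ m n (T-≡true m≡ᵇn)

  private variable A B : Set

  countᵇ-∷ : ∀ (p : A → Bool) x xs →
    countᵇ p (x ∷ xs) ≡ (if p x then suc (countᵇ p xs) else countᵇ p xs)
  countᵇ-∷ p x xs with p x
  ... | true  = refl
  ... | false = refl

  countᵇ-≤-length : ∀ (p : A → Bool) xs → countᵇ p xs ≤ length xs
  countᵇ-≤-length p = List.length-filter (T? ∘ p)

  countᵇ-none : ∀ (p : A → Bool) {xs} → All (λ x → p x ≡ false) xs → countᵇ p xs ≡ 0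
  countᵇ-none p none = cong length (List.filter-none (T? ∘ p) (All.map (λ { px≡f t → subst T px≡f t }) none))

  countᵇ-↭ : ∀ (p : A → Bool) {xs ys} → xs ↭ ys → countᵇ p xs ≡ countᵇ p ys
  countᵇ-↭ p = ↭-length ∘ filter-↭ (T? ∘ p)

  countᵇ-cong : ∀ (p q : A → Bool) {xs} → All (λ x → p x ≡ q x) xs → countᵇ p xs ≡ countᵇ q xs
  countᵇ-cong p q []                 = refl
  countᵇ-cong p q {x ∷ xs} (px≡qx ∷ eqs)
    rewrite countᵇ-∷ p x xs | countᵇ-∷ q x xs | px≡qx | countᵇ-cong p q eqs = refl

  countᵇ-complement : ∀ (p q : A → Bool) {xs} → All (λ x → p x ≡ not (q x)) xs →
    countᵇ p xs + countᵇ q xs ≡ length xs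
  countᵇ-complement p q [] = refl
  countᵇ-complement p q {x ∷ xs} (px≡¬qx ∷ eqs)
    rewrite countᵇ-∷ p x xs | countᵇ-∷ q x xs | px≡¬qx with q x
  ... | true  = trans (+-suc _ _) (cong suc (countᵇ-complement p q eqs))
  ... | false = cong suc (countᵇ-complement p q eqs)

  countᵇ-map : ∀ (p : B → Bool) (f : A → B) xs → countᵇ p (map f xs) ≡ countᵇ (p ∘ f) xs
  countᵇ-map p f []       = refl
  countᵇ-map p f (x ∷ xs)
    rewrite countᵇ-∷ p (f x) (map f xs) | countᵇ-∷ (p ∘ f) x xs | countᵇ-map p f xs = refl

  countᵇ-involution : ∀ {xs} (f : A → A) → Unique xs → (∀ x → f (f x) ≡ x) →
    (∀ {x} → x ∈ xs → f x ∈ xs) → ∀ (p : A → Bool) → countᵇ p xs ≡ countᵇ (p ∘ f) xs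
  countᵇ-involution {xs = xs} f uniq invol closed p =
    trans (countᵇ-↭ p (↭-sym f[xs]↭xs)) (countᵇ-map p f xs)
    where
    injective : ∀ {x y} → f x ≡ f y → x ≡ y
    injective {x} {y} fx≡fy = trans (sym (invol x)) (trans (cong f fx≡fy) (invol y))
    to : ∀ {x} → x ∈ map f xs → x ∈ xs
    to x∈ with ∈-map⁻ f x∈
    ... | y , y∈xs , refl = closed y∈xs
    from : ∀ {x} → x ∈ xs → x ∈ map f xs
    from {x} x∈xs = subst (_∈ map f xs) (invol x) (∈-map⁺ f (closed x∈xs))
    f[xs]↭xs : map f xs ↭ xs
    f[xs]↭xs = ∼bag⇒↭ (unique∧set⇒bag (Unique.map⁺ injective uniq) uniq (mk⇔ to from))

  countᵇ-unique-one : ∀ (f : A → ℕ) {xs a} → Unique (map f xs) → a ∈ xs →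
    countᵇ (λ x → f x ≡ᵇ f a) xs ≡ 1
  countᵇ-unique-one f {x ∷ xs} (x∉ ∷ _) (here refl)
    rewrite countᵇ-∷ (λ y → f y ≡ᵇ f x) x xs | T-injective {f x ≡ᵇ f x} {true} _ (λ _ → ≡⇒≡ᵇ (f x) (f x) refl) =
    cong suc (countᵇ-none _ (All.map (λ fx≢fy → T-injective (λ t → fx≢fy (sym (≡ᵇ⇒≡ _ _ t))) λ ()) (AllP.map⁻ x∉)))
  countᵇ-unique-one f {x ∷ xs} {a} (x∉ ∷ uniq) (there a∈xs)
    rewrite countᵇ-∷ (λ y → f y ≡ᵇ f a) x xs
          | T-injective {f x ≡ᵇ f a} {false} (λ t → All.lookup x∉ (∈-map⁺ f a∈xs) (≡ᵇ⇒≡ _ _ t)) λ () =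
    countᵇ-unique-one f uniq a∈xs

  m+2[1+k]≡2+[m+2k] : ∀ m k → m + 2 * suc k ≡ 2 + (m + 2 * k)
  m+2[1+k]≡2+[m+2k] = solve-∀

  countᵇ-flip : ∀ (a b c : A → Bool) {xs} → All (λ x → a x ≡ (if b x then not (c x) else c x)) xs →
    countᵇ a xs + countᵇ b xs ≡ countᵇ c xs + 2 * countᵇ (λ x → b x ∧ not (c x)) xs
  countᵇ-flip a b c [] = refl
  countᵇ-flip a b c {x ∷ xs} (ax ∷ axs)
    rewrite countᵇ-∷ a x xs | countᵇ-∷ b x xs | countᵇ-∷ c x xs
          | countᵇ-∷ (λ x → b x ∧ not (c x)) x xs | ax
    with b x | c x | countᵇ-flip a b c axs
  ... | true  | true  | ih = trans (+-suc _ _) (cong suc ih)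
  ... | true  | false | ih = trans (cong suc (+-suc _ _)) (trans (cong (suc ∘ suc) ih) (sym (m+2[1+k]≡2+[m+2k] _ _)))
  ... | false | true  | ih = cong suc ih
  ... | false | false | ih = ih

  isEven-suc : ∀ m → isEven (suc m) ≡ not (isEven m)
  isEven-suc zero          = refl
  isEven-suc (suc zero)    = refl
  isEven-suc (suc (suc m)) = isEven-suc m

  isEven-+ : ∀ m n → isEven (m + n) ≡ not (isEven m) xor isEven n
  isEven-+ zero    n = refl
  isEven-+ (suc m) n = begin
    isEven (suc (m + n))                  ≡⟨ isEven-suc (m + n) ⟩
    not (isEven (m + n))                  ≡⟨ cong not (isEven-+ m n) ⟩
    not (not (isEven m) xor isEven n)     ≡⟨ not-distribˡ-xor (not (isEven m)) (isEven n) ⟩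
    not (not (isEven m)) xor isEven n     ≡⟨ cong (λ e → not e xor isEven n) (isEven-suc m) ⟨
    not (isEven (suc m)) xor isEven n     ∎
    where open ≡-Reasoning

  isEven-+-2* : ∀ m k → isEven (m + 2 * k) ≡ isEven m
  isEven-+-2* m zero    = cong isEven (+-identityʳ m)
  isEven-+-2* m (suc k) = trans (cong isEven (m+2[1+k]≡2+[m+2k] m k)) (isEven-+-2* m k)

  isEven-summand : ∀ {m n N} → m + n ≡ N → isEven m ≡ not (isEven N) xor isEven n
  isEven-summand {m} {n} refl = begin
    isEven m                                           ≡⟨ xor-identityʳ (isEven m) ⟨
    isEven m xor false                                 ≡⟨ cong (isEven m xor_) (xor-same (isEven n)) ⟨
    isEven m xor (isEven n xor isEven n)               ≡⟨ xor-assoc (isEven m) (isEven n) (isEven n) ⟨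
    (isEven m xor isEven n) xor isEven n               ≡⟨ cong (λ e → (e xor isEven n) xor isEven n) (not-involutive (isEven m)) ⟨
    (not (not (isEven m)) xor isEven n) xor isEven n   ≡⟨ cong (_xor isEven n) (not-distribˡ-xor (not (isEven m)) (isEven n)) ⟨
    not (not (isEven m) xor isEven n) xor isEven n     ≡⟨ cong (λ e → not e xor isEven n) (isEven-+ m n) ⟨
    not (isEven (m + n)) xor isEven n                  ∎
    where open ≡-Reasoning

  -- The enumeration Bn of signed permutations

  ∈-signedVals⁻ : ∀ {n x} → x ∈ signedVals n → ∃[ i ] i < n × ∣ x ∣ ≡ suc i
  ∈-signedVals⁻ {n} x∈ with ∈-++⁻ (map -[1+_] (upTo n)) x∈
  ... | inj₁ x∈neg with i , i∈ , refl ← ∈-map⁻ -[1+_] x∈neg = i , ∈-upTo⁻ i∈ , refl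
  ... | inj₂ x∈pos with i , i∈ , refl ← ∈-map⁻ (λ i → + suc i) x∈pos = i , ∈-upTo⁻ i∈ , refl

  ∈-signedVals⁺ : ∀ {n i} x → i < n → ∣ x ∣ ≡ suc i → x ∈ signedVals n
  ∈-signedVals⁺ {n} (+ suc i) i<n refl = ∈-++⁺ʳ (map -[1+_] (upTo n)) (∈-map⁺ (λ i → + suc i) (∈-upTo⁺ i<n))
  ∈-signedVals⁺ -[1+ i ]      i<n refl = ∈-++⁺ˡ (∈-map⁺ -[1+_] (∈-upTo⁺ i<n))

  signedVals-respects-∣∣ : ∀ {n x} y → x ∈ signedVals n → ∣ y ∣ ≡ ∣ x ∣ → y ∈ signedVals n
  signedVals-respects-∣∣ {n} y x∈ ∣y∣≡∣x∣ with i , i<n , ∣x∣≡1+i ← ∈-signedVals⁻ {n} x∈ =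
    ∈-signedVals⁺ y i<n (trans ∣y∣≡∣x∣ ∣x∣≡1+i)

  signedVals-∣∣≢0 : ∀ n {x} → x ∈ signedVals n → ∣ x ∣ ≢ 0
  signedVals-∣∣≢0 n x∈ with _ , _ , ∣x∣≡1+i ← ∈-signedVals⁻ {n} x∈ = 1+n≢0 ∘ trans (sym ∣x∣≡1+i)

  signedVals-unique : ∀ n → Unique (signedVals n)
  signedVals-unique n = Unique.++⁺ (Unique.map⁺ neg-injective (Unique.upTo⁺ n))
                                   (Unique.map⁺ pos-injective (Unique.upTo⁺ n)) disjoint
    where
    neg-injective : ∀ {i j} → -[1+ i ] ≡ -[1+ j ] → i ≡ j
    neg-injective refl = refl
    pos-injective : ∀ {i j} → + suc i ≡ + suc j → i ≡ j
    pos-injective refl = refl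
    disjoint : ∀ {v} → ¬ (v ∈ map -[1+_] (upTo n) × v ∈ map (λ i → + suc i) (upTo n))
    disjoint (v∈neg , v∈pos) with _ , _ , refl ← ∈-map⁻ -[1+_] v∈neg | _ , _ , () ← ∈-map⁻ (λ i → + suc i) v∈pos

  concatMap-cartesianProductWith : ∀ {C : Set} (f : A → B → C) xs ys →
    concatMap (λ x → map (f x) ys) xs ≡ cartesianProductWith f xs ys
  concatMap-cartesianProductWith f []       ys = refl
  concatMap-cartesianProductWith f (x ∷ xs) ys = cong (map (f x) ys ++_) (concatMap-cartesianProductWith f xs ys)

  words-suc : ∀ n len → words n (suc len) ≡ cartesianProductWith _∷_ (signedVals n) (words n len)
  words-suc n len = concatMap-cartesianProductWith _∷_ (signedVals n) (words n len)

  ∈-words⁻ : ∀ n len {w} → w ∈ words n len → length w ≡ len × All (_∈ signedVals n) w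
  ∈-words⁻ n zero      (here refl) = refl , []
  ∈-words⁻ n (suc len) w∈
    with x , u , x∈ , u∈ , refl ← ∈-cartesianProductWith⁻ _∷_ (signedVals n) (words n len) (subst (_ ∈_) (words-suc n len) w∈)
    with ∣u∣≡len , u⊆ ← ∈-words⁻ n len u∈ = cong suc ∣u∣≡len , x∈ ∷ u⊆

  ∈-words⁺ : ∀ n len {w} → length w ≡ len → All (_∈ signedVals n) w → w ∈ words n len
  ∈-words⁺ n zero      {[]}    _       []          = here refl
  ∈-words⁺ n (suc len) {x ∷ w} ∣w∣≡len (x∈ ∷ w⊆) = subst (_ ∈_) (sym (words-suc n len))
    (∈-cartesianProductWith⁺ _∷_ x∈ (∈-words⁺ n len (suc-injective ∣w∣≡len) w⊆))

  words-unique : ∀ n len → Unique (words n len)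
  words-unique n zero      = [] ∷ []
  words-unique n (suc len) = subst Unique (sym (words-suc n len))
    (Unique.cartesianProductWith⁺ _∷_ List.∷-injective (signedVals-unique n) (words-unique n len))

  distinctᵇ⇒Unique : ∀ xs → T (distinctᵇ xs) → Unique xs
  distinctᵇ⇒Unique []       _ = []
  distinctᵇ⇒Unique (x ∷ xs) t with x-fresh , xs-distinct ← Equivalence.to T-∧ t =
    All.tabulate x≢ ∷ distinctᵇ⇒Unique xs xs-distinct
    where
    x≢ : ∀ {y} → y ∈ xs → x ≢ y
    x≢ y∈xs refl = subst T (Equivalence.to T-not-≡ x-fresh)
      (any⁺ (x ≡ᵇ_) (Any.map (λ { refl → ≡⇒≡ᵇ x x refl }) y∈xs))

  ∈-Bn⁻ : ∀ n {w} → w ∈ Bn n → length w ≡ n × All (_∈ signedVals n) w × Unique (map ∣_∣ w)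
  ∈-Bn⁻ n w∈ with w∈words , distinct ← ∈-filter⁻ (T? ∘ isSignedPerm) {xs = words n n} w∈
    with ∣w∣≡n , w⊆ ← ∈-words⁻ n n w∈words = ∣w∣≡n , w⊆ , distinctᵇ⇒Unique _ distinct

  Bn-respects-∣∣ : ∀ n {w w′} → w ∈ Bn n → map ∣_∣ w′ ≡ map ∣_∣ w → w′ ∈ Bn n
  Bn-respects-∣∣ n {w} {w′} w∈ same-∣∣ with ∣w∣≡n , w⊆ , _ ← ∈-Bn⁻ n w∈ =
    ∈-filter⁺ (T? ∘ isSignedPerm) (∈-words⁺ n n ∣w′∣≡n (w′⊆ w⊆ same-∣∣)) distinct
    where
    ∣w′∣≡n : length w′ ≡ n
    ∣w′∣≡n = trans (sym (List.length-map ∣_∣ w′)) (trans (cong length same-∣∣) (trans (List.length-map ∣_∣ w) ∣w∣≡n))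
    w′⊆ : ∀ {u u′} → All (_∈ signedVals n) u → map ∣_∣ u′ ≡ map ∣_∣ u → All (_∈ signedVals n) u′
    w′⊆ {[]}    {[]}      []         _  = []
    w′⊆ {_ ∷ _} {x′ ∷ _} (x∈ ∷ u⊆) eq =
      signedVals-respects-∣∣ {n} x′ x∈ (List.∷-injectiveˡ eq) ∷ w′⊆ u⊆ (List.∷-injectiveʳ eq)
    distinct : T (isSignedPerm w′)
    distinct = subst T (cong distinctᵇ (sym same-∣∣)) (proj₂ (∈-filter⁻ (T? ∘ isSignedPerm) {xs = words n n} w∈))

  Bn-unique : ∀ n → Unique (Bn n)
  Bn-unique n = Unique.filter⁺ (T? ∘ isSignedPerm) (words-unique n n)

  countᵇ-Bn-involution : ∀ n (f : List ℤ → List ℤ) → (∀ w → f (f w) ≡ w) → (∀ w → map ∣_∣ (f w) ≡ map ∣_∣ w) →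
    ∀ p → countᵇ p (Bn n) ≡ countᵇ (p ∘ f) (Bn n)
  countᵇ-Bn-involution n f invol same-∣∣ =
    countᵇ-involution f (Bn-unique n) invol (λ w∈ → Bn-respects-∣∣ n w∈ (same-∣∣ _))

  enumerateFrom : ℕ → List A → List (ℕ × A)
  enumerateFrom i []       = []
  enumerateFrom i (x ∷ xs) = (i , x) ∷ enumerateFrom (suc i) xs

  map-proj₂-enumerateFrom : ∀ i (xs : List A) → map proj₂ (enumerateFrom i xs) ≡ xs
  map-proj₂-enumerateFrom i []       = refl
  map-proj₂-enumerateFrom i (x ∷ xs) = cong (x ∷_) (map-proj₂-enumerateFrom (suc i) xs)

  drop-enumerateFrom : ∀ i k (xs : List A) → drop k (enumerateFrom i xs) ≡ enumerateFrom (i + k) (drop k xs)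
  drop-enumerateFrom i zero    xs       = cong (λ j → enumerateFrom j xs) (sym (+-identityʳ i))
  drop-enumerateFrom i (suc k) []       = refl
  drop-enumerateFrom i (suc k) (x ∷ xs) = trans (drop-enumerateFrom (suc i) k xs) (cong (λ j → enumerateFrom j (drop k xs)) (sym (+-suc i k)))

  ∈-drop⁻ : ∀ k {xs : List A} {x} → x ∈ drop k xs → x ∈ xs
  ∈-drop⁻ zero            x∈ = x∈
  ∈-drop⁻ (suc k) {_ ∷ _} x∈ = there (∈-drop⁻ k x∈)

  ∈-enumerateFrom⁻ : ∀ i {xs : List A} {j x} → (j , x) ∈ enumerateFrom i xs → x ∈ xs
  ∈-enumerateFrom⁻ i {_ ∷ _} (here refl) = here refl
  ∈-enumerateFrom⁻ i {_ ∷ _} (there j,x∈) = there (∈-enumerateFrom⁻ (suc i) j,x∈)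

  enumerateFrom-index-unique : ∀ (f : A → ℕ) i {xs} → Unique (map f xs) → ∀ {j j′ x x′} →
    (j , x) ∈ enumerateFrom i xs → (j′ , x′) ∈ enumerateFrom i xs → f x ≡ f x′ → j ≡ j′
  enumerateFrom-index-unique f i {_ ∷ _} _ (here refl) (here refl) _ = refl
  enumerateFrom-index-unique f i {_ ∷ xs} (x∉ ∷ _) (here refl) (there j′,x′∈) fx≡fx′ =
    ⊥-elim (All.lookup x∉ (∈-map⁺ f (∈-enumerateFrom⁻ (suc i) j′,x′∈)) fx≡fx′)
  enumerateFrom-index-unique f i {_ ∷ xs} (x′∉ ∷ _) (there j,x∈) (here refl) fx≡fx′ =
    ⊥-elim (All.lookup x′∉ (∈-map⁺ f (∈-enumerateFrom⁻ (suc i) j,x∈)) (sym fx≡fx′))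
  enumerateFrom-index-unique f i {_ ∷ xs} (_ ∷ uniq) (there j,x∈) (there j′,x′∈) fx≡fx′ =
    enumerateFrom-index-unique f (suc i) uniq j,x∈ j′,x′∈ fx≡fx′

  All-zip-enumerateFrom : ∀ (Φ : ℕ × A → ℕ × A → Set) i d (xs ys : List A) →
    (∀ {j x y} → (j , x) ∈ enumerateFrom i xs → (j + d , y) ∈ enumerateFrom (i + d) ys → Φ (j , x) (j + d , y)) →
    All (λ p → Φ (proj₁ p) (proj₂ p)) (zip (enumerateFrom i xs) (enumerateFrom (i + d) ys))
  All-zip-enumerateFrom Φ i d []       ys       Φ-holds = []
  All-zip-enumerateFrom Φ i d (x ∷ xs) []       Φ-holds = []
  All-zip-enumerateFrom Φ i d (x ∷ xs) (y ∷ ys) Φ-holds =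
    Φ-holds (here refl) (here refl) ∷ All-zip-enumerateFrom Φ (suc i) d xs ys (λ x∈ y∈ → Φ-holds (there x∈) (there y∈))

  All-zip-drop : ∀ (Φ : A → A → Set) k (xs : List A) →
    (∀ {j x y} → (j , x) ∈ enumerateFrom 0 xs → (j + k , y) ∈ enumerateFrom 0 xs → Φ x y) →
    All (λ p → Φ (proj₁ p) (proj₂ p)) (zip xs (drop k xs))
  All-zip-drop Φ k xs Φ-holds = subst (All (λ p → Φ (proj₁ p) (proj₂ p))) zip-as-map
    (AllP.map⁺ (All-zip-enumerateFrom (λ p q → Φ (proj₂ p) (proj₂ q)) 0 k xs (drop k xs)
      (λ x∈ y∈ → Φ-holds x∈ (∈-drop⁻ k (subst (_ ∈_) (sym (drop-enumerateFrom 0 k xs)) y∈)))))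
    where
    E = enumerateFrom 0 xs
    zip-as-map : map (Product.map proj₂ proj₂) (zip E (enumerateFrom k (drop k xs))) ≡ zip xs (drop k xs)
    zip-as-map = begin
      map (Product.map proj₂ proj₂) (zip E (enumerateFrom k (drop k xs)))
        ≡⟨ List.zip-map proj₂ proj₂ E (enumerateFrom k (drop k xs)) ⟨
      zip (map proj₂ E) (map proj₂ (enumerateFrom k (drop k xs)))
        ≡⟨ cong₂ zip (map-proj₂-enumerateFrom 0 xs) (map-proj₂-enumerateFrom k (drop k xs)) ⟩
      zip xs (drop k xs) ∎
      where open ≡-Reasoning

  -- Descents under negation

  ≤ᵇ-swap : ∀ {a b : ℤ} → a ≢ b → (b ℤ.≤ᵇ a) ≡ not (a ℤ.≤ᵇ b)
  ≤ᵇ-swap {a} {b} a≢b with a ℤ.≤ᵇ b in a≤b | b ℤ.≤ᵇ a in b≤a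
  ... | true  | true  = ⊥-elim (a≢b (ℤ.≤-antisym (ℤ.≤ᵇ⇒≤ (T-≡true a≤b)) (ℤ.≤ᵇ⇒≤ (T-≡true b≤a))))
  ... | true  | false = refl
  ... | false | true  = refl
  ... | false | false with ℤ.≤-total a b
  ...   | inj₁ a≤b′ = ⊥-elim (subst T a≤b (ℤ.≤⇒≤ᵇ a≤b′))
  ...   | inj₂ b≤a′ = ⊥-elim (subst T b≤a (ℤ.≤⇒≤ᵇ b≤a′))

  -≤ᵇ- : ∀ (a b : ℤ) → (- a ℤ.≤ᵇ - b) ≡ (b ℤ.≤ᵇ a)
  -≤ᵇ- a b = T-injective
    (λ t → ℤ.≤⇒≤ᵇ (ℤ.neg-cancel-≤ {a} {b} (ℤ.≤ᵇ⇒≤ t)))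
    (λ t → ℤ.≤⇒≤ᵇ (ℤ.neg-mono-≤ {b} {a} (ℤ.≤ᵇ⇒≤ t)))

  ≤ᵇ-by-sign-of-rhs : ∀ a b → ∣ a ∣ ℕ.< ∣ b ∣ → (a ℤ.≤ᵇ b) ≡ (+ 0 ℤ.≤ᵇ b)
  ≤ᵇ-by-sign-of-rhs (+ x)    (+ y)    ∣a∣<∣b∣ = T-injective (λ _ → _) (λ _ → ℕ.≤⇒≤ᵇ (ℕ.<⇒≤ ∣a∣<∣b∣))
  ≤ᵇ-by-sign-of-rhs (+ x)    -[1+ y ] ∣a∣<∣b∣ = refl
  ≤ᵇ-by-sign-of-rhs -[1+ x ] (+ y)    ∣a∣<∣b∣ = refl
  ≤ᵇ-by-sign-of-rhs -[1+ x ] -[1+ y ] ∣a∣<∣b∣ = T-injective (λ t → ⊥-elim (ℕ.<⇒≱ (ℕ.s≤s⁻¹ ∣a∣<∣b∣) (ℕ.≤ᵇ⇒≤ y x t))) λ ()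

  ≤ᵇ-by-sign-of-lhs : ∀ a b → ∣ b ∣ ℕ.< ∣ a ∣ → (a ℤ.≤ᵇ b) ≡ (a ℤ.≤ᵇ + 0)
  ≤ᵇ-by-sign-of-lhs (+ x)    (+ y)    ∣b∣<∣a∣ =
    T-injective (λ t → ⊥-elim (ℕ.<⇒≱ ∣b∣<∣a∣ (ℕ.≤ᵇ⇒≤ x y t))) (λ t → ⊥-elim (ℕ.<⇒≱ (ℕ.≤-<-trans ℕ.z≤n ∣b∣<∣a∣) (ℕ.≤ᵇ⇒≤ x 0 t)))
  ≤ᵇ-by-sign-of-lhs (+ x)    -[1+ y ] ∣b∣<∣a∣ = T-injective (λ ()) (λ t → ⊥-elim (ℕ.<⇒≱ (ℕ.≤-<-trans ℕ.z≤n ∣b∣<∣a∣) (ℕ.≤ᵇ⇒≤ x 0 t)))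
  ≤ᵇ-by-sign-of-lhs -[1+ x ] (+ y)    ∣b∣<∣a∣ = refl
  ≤ᵇ-by-sign-of-lhs -[1+ x ] -[1+ y ] ∣b∣<∣a∣ = T-injective (λ _ → _) (λ _ → ℕ.≤⇒≤ᵇ (ℕ.<⇒≤ (ℕ.s≤s⁻¹ ∣b∣<∣a∣)))

  -≤ᵇ-smaller : ∀ a b → ∣ a ∣ ℕ.< ∣ b ∣ → (- a ℤ.≤ᵇ b) ≡ (a ℤ.≤ᵇ b)
  -≤ᵇ-smaller a b ∣a∣<∣b∣ = trans
    (≤ᵇ-by-sign-of-rhs (- a) b (subst (ℕ._< ∣ b ∣) (sym (ℤ.∣-i∣≡∣i∣ a)) ∣a∣<∣b∣))
    (sym (≤ᵇ-by-sign-of-rhs a b ∣a∣<∣b∣))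

  ≤ᵇ-smaller- : ∀ a b → ∣ b ∣ ℕ.< ∣ a ∣ → (a ℤ.≤ᵇ - b) ≡ (a ℤ.≤ᵇ b)
  ≤ᵇ-smaller- a b ∣b∣<∣a∣ = trans
    (≤ᵇ-by-sign-of-lhs a (- b) (subst (ℕ._< ∣ a ∣) (sym (ℤ.∣-i∣≡∣i∣ b)) ∣b∣<∣a∣))
    (sym (≤ᵇ-by-sign-of-lhs a b ∣b∣<∣a∣))

  length-zip-drop : ∀ k (xs : List A) → length (zip xs (drop k xs)) ≡ length xs ∸ k
  length-zip-drop k xs = begin
    length (zip xs (drop k xs))             ≡⟨ List.length-zipWith _,_ xs (drop k xs) ⟩
    length xs ℕ.⊓ length (drop k xs)        ≡⟨ cong (length xs ℕ.⊓_) (List.length-drop k xs) ⟩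
    length xs ℕ.⊓ (length xs ∸ k)           ≡⟨ ℕ.m≥n⇒m⊓n≡n (ℕ.m∸n≤m (length xs) k) ⟩
    length xs ∸ k                           ∎
    where open ≡-Reasoning

  zip-drop-map : ∀ (f : A → B) k xs → zip (map f xs) (drop k (map f xs)) ≡ map (Product.map f f) (zip xs (drop k xs))
  zip-drop-map f k xs = trans (cong (zip (map f xs)) (List.drop-map k xs)) (List.zip-map f f xs (drop k xs))

  entries-at-distance-differ : ∀ k {xs : List ℤ} → Unique (map ∣_∣ xs) → ∀ {j x y} →
    (j , x) ∈ enumerateFrom 0 xs → (j + suc k , y) ∈ enumerateFrom 0 xs → ∣ x ∣ ≢ ∣ y ∣
  entries-at-distance-differ k uniq {j} x∈ y∈ ∣x∣≡∣y∣ =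
    ℕ.m+1+n≢m j (sym (enumerateFrom-index-unique ∣_∣ 0 uniq x∈ y∈ ∣x∣≡∣y∣))

  descent : ℤ × ℤ → Bool
  descent p = not (proj₁ p ℤ.≤ᵇ proj₂ p)

  descent-neg : ∀ {a b} → a ≢ b → descent (- a , - b) ≡ not (descent (a , b))
  descent-neg {a} {b} a≢b = cong not (trans (-≤ᵇ- a b) (≤ᵇ-swap a≢b))

  descents-neg : ∀ k (xs : List ℤ) → Unique (map ∣_∣ xs) →
    countᵇ descent (zip (map -_ xs) (drop (suc k) (map -_ xs))) + countᵇ descent (zip xs (drop (suc k) xs))
      ≡ length xs ∸ suc k
  descents-neg k xs uniq = begin
    countᵇ descent (zip (map -_ xs) (drop (suc k) (map -_ xs))) + countᵇ descent P
      ≡⟨ cong (λ ps → countᵇ descent ps + countᵇ descent P) (zip-drop-map -_ (suc k) xs) ⟩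
    countᵇ descent (map (Product.map -_ -_) P) + countᵇ descent P
      ≡⟨ cong (_+ countᵇ descent P) (countᵇ-map descent (Product.map -_ -_) P) ⟩
    countᵇ (descent ∘ Product.map -_ -_) P + countᵇ descent P
      ≡⟨ countᵇ-complement _ descent (All-zip-drop _ (suc k) xs λ {_} {x} {y} x∈ y∈ → descent-neg {x} {y} (λ x≡y → entries-at-distance-differ k uniq x∈ y∈ (cong ∣_∣ x≡y))) ⟩
    length P
      ≡⟨ length-zip-drop (suc k) xs ⟩
    length xs ∸ suc k ∎
    where
    open ≡-Reasoning
    P = zip xs (drop (suc k) xs)

  Bn-∣∣-unique₀ : ∀ n {w} → w ∈ Bn n → Unique (map ∣_∣ (+ 0 ∷ w))
  Bn-∣∣-unique₀ n w∈ with _ , w⊆ , uniq ← ∈-Bn⁻ n w∈ =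
    AllP.map⁺ (All.map (λ x∈ 0≡∣x∣ → signedVals-∣∣≢0 n x∈ (sym 0≡∣x∣)) w⊆) ∷ uniq

  desB-≤ : ∀ n k {w} → w ∈ Bn n → desB (suc k) w ≤ n ∸ k
  desB-≤ n k {w} w∈ = subst (desB (suc k) w ≤_)
    (trans (length-zip-drop (suc k) (+ 0 ∷ w)) (cong (_∸ k) (proj₁ (∈-Bn⁻ n w∈))))
    (countᵇ-≤-length descent (zip (+ 0 ∷ w) (drop (suc k) (+ 0 ∷ w))))

  desB-neg : ∀ n k {w} → w ∈ Bn n → desB (suc k) (map -_ w) + desB (suc k) w ≡ n ∸ k
  desB-neg n k {w} w∈ = trans (descents-neg k (+ 0 ∷ w) (Bn-∣∣-unique₀ n w∈)) (cong (_∸ k) (proj₁ (∈-Bn⁻ n w∈)))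

  negative : ℤ → Bool
  negative x = not (+ 0 ℤ.≤ᵇ x)

  negative-neg : ∀ x → ∣ x ∣ ≢ 0 → negative (- x) ≡ not (negative x)
  negative-neg (+ zero)  ∣x∣≢0 = ⊥-elim (∣x∣≢0 refl)
  negative-neg (+ suc x) _     = refl
  negative-neg -[1+ x ]  _     = refl

  negs-neg : ∀ n {w} → w ∈ Bn n → negs (map -_ w) + negs w ≡ n
  negs-neg n {w} w∈ with ∣w∣≡n , w⊆ , _ ← ∈-Bn⁻ n w∈ = begin
    negs (map -_ w) + negs w             ≡⟨ cong (_+ negs w) (countᵇ-map negative -_ w) ⟩
    countᵇ (negative ∘ -_) w + negs w    ≡⟨ countᵇ-complement _ negative (All.map (λ {x} x∈ → negative-neg x (signedVals-∣∣≢0 n x∈)) w⊆) ⟩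
    length w                             ≡⟨ ∣w∣≡n ⟩
    n                                    ∎
    where open ≡-Reasoning

  inD-neg : ∀ n {w} → w ∈ Bn n → inD (map -_ w) ≡ not (isEven n) xor inD w
  inD-neg n {w} w∈ = isEven-summand {negs (map -_ w)} {negs w} (negs-neg n w∈)

  -- Negating the pivot

  enumerateFrom-map : ∀ (f : A → B) i xs → enumerateFrom i (map f xs) ≡ map (Product.map₂ f) (enumerateFrom i xs)
  enumerateFrom-map f i []       = refl
  enumerateFrom-map f i (x ∷ xs) = cong ((i , f x) ∷_) (enumerateFrom-map f (suc i) xs)

  module PivotFlip (j : ℕ) where

    K : ℕ
    K = 2 + j

    inClass : ℕ × A → Bool
    inClass e = proj₁ e % K ≡ᵇ 1

    -- Minimum of ∣π(i)∣ over i ≡ 1 (mod K); the default ∣π(1)∣ is itself one of these values.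
    classMin : List ℕ → ℕ
    classMin []       = 0
    classMin (a ∷ as) = min a (map proj₂ (filterᵇ inClass (enumerateFrom 1 (a ∷ as))))

    pivotAbs : List ℤ → ℕ
    pivotAbs w = classMin (map ∣_∣ w)

    flipAbs : ℕ → ℤ → ℤ
    flipAbs m x = if ∣ x ∣ ≡ᵇ m then - x else x

    flipPivot : List ℤ → List ℤ
    flipPivot w = map (flipAbs (pivotAbs w)) w

    flipAbs-∣∣ : ∀ m x → ∣ flipAbs m x ∣ ≡ ∣ x ∣
    flipAbs-∣∣ m x with ∣ x ∣ ≡ᵇ m
    ... | true  = ℤ.∣-i∣≡∣i∣ x
    ... | false = refl

    flipAbs-involutive : ∀ m x → flipAbs m (flipAbs m x) ≡ x
    flipAbs-involutive m x with ∣ x ∣ ≡ᵇ m in ∣x∣≡m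
    ... | true  rewrite ℤ.∣-i∣≡∣i∣ x | ∣x∣≡m = ℤ.neg-involutive x
    ... | false rewrite ∣x∣≡m = refl

    flipAbs-0 : ∀ m → flipAbs m (+ 0) ≡ + 0
    flipAbs-0 m with 0 ≡ᵇ m
    ... | true  = refl
    ... | false = refl

    flipPivot-∣∣ : ∀ w → map ∣_∣ (flipPivot w) ≡ map ∣_∣ w
    flipPivot-∣∣ w = trans (sym (List.map-∘ w)) (List.map-cong (flipAbs-∣∣ (pivotAbs w)) w)

    flipPivot-involutive : ∀ w → flipPivot (flipPivot w) ≡ w
    flipPivot-involutive w rewrite flipPivot-∣∣ w =
      trans (sym (List.map-∘ w)) (trans (List.map-cong (flipAbs-involutive (pivotAbs w)) w) (List.map-id w))

    pivotAbs-≤ : ∀ w {i y} → (i , y) ∈ enumerateFrom 0 (+ 0 ∷ w) → i % K ≡ 1 → pivotAbs w ≤ ∣ y ∣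
    pivotAbs-≤ w       (here refl) ()
    pivotAbs-≤ (x ∷ w) {i} {y} (there i,y∈) i%K≡1 = All.lookup (min≤xs ∣ x ∣ _)
      (∈-map⁺ proj₂ (∈-filter⁺ (T? ∘ inClass) i,∣y∣∈ (≡⇒≡ᵇ (i % K) 1 i%K≡1)))
      where
      i,∣y∣∈ : (i , ∣ y ∣) ∈ enumerateFrom 1 (map ∣_∣ (x ∷ w))
      i,∣y∣∈ = subst ((i , ∣ y ∣) ∈_) (sym (enumerateFrom-map ∣_∣ 1 (x ∷ w))) (∈-map⁺ (Product.map₂ ∣_∣) i,y∈)

    pivotAbs-attained : ∀ x w → ∃[ i ] ∃[ y ] (i , y) ∈ enumerateFrom 0 (+ 0 ∷ x ∷ w) × i % K ≡ 1 × ∣ y ∣ ≡ pivotAbs (x ∷ w)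
    pivotAbs-attained x w with argmin-sel id ∣ x ∣ (map proj₂ (filterᵇ inClass (enumerateFrom 1 (map ∣_∣ (x ∷ w)))))
    ... | inj₁ min≡∣x∣ = 1 , x , there (here refl) , refl , sym min≡∣x∣
    ... | inj₂ min∈
      with (i , v) , i,v∈ , min≡v ← ∈-map⁻ proj₂ min∈
      with i,v∈E , i∈class ← ∈-filter⁻ (T? ∘ inClass) {xs = enumerateFrom 1 (map ∣_∣ (x ∷ w))} i,v∈
      with (_ , y) , i,y∈ , refl ← ∈-map⁻ (Product.map₂ ∣_∣) (subst ((i , v) ∈_) (enumerateFrom-map ∣_∣ 1 (x ∷ w)) i,v∈E)
      = i , y , there i,y∈ , ≡ᵇ⇒≡ (i % K) 1 i∈class , sym min≡v

    module _ (x : ℤ) (w : List ℤ) (uniq : Unique (map ∣_∣ (+ 0 ∷ x ∷ w))) where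

      private
        m = pivotAbs (x ∷ w)
        E = enumerateFrom 0 (+ 0 ∷ x ∷ w)

      pivotAbs-position : ∀ {i y} → (i , y) ∈ E → ∣ y ∣ ≡ m → i % K ≡ 1
      pivotAbs-position i,y∈ ∣y∣≡m with i₀ , y₀ , i₀,y₀∈ , i₀%K≡1 , ∣y₀∣≡m ← pivotAbs-attained x w =
        trans (cong (_% K) (enumerateFrom-index-unique ∣_∣ 0 uniq i,y∈ i₀,y₀∈ (trans ∣y∣≡m (sym ∣y₀∣≡m)))) i₀%K≡1

      descent-flipAbs : ∀ {i a b} → (i , a) ∈ E → (i + K , b) ∈ E →
        descent (flipAbs m a , flipAbs m b) ≡ descent (a , b)
      descent-flipAbs {i} {a} {b} a∈ b∈ with ∣ a ∣ ≡ᵇ m in ∣a∣≡ᵇm | ∣ b ∣ ≡ᵇ m in ∣b∣≡ᵇm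
      ... | true  | true  = ⊥-elim (∣a∣≢∣b∣ (trans (≡ᵇ-true⇒≡ ∣a∣≡ᵇm) (sym (≡ᵇ-true⇒≡ ∣b∣≡ᵇm))))
        where ∣a∣≢∣b∣ = entries-at-distance-differ (suc j) uniq a∈ b∈
      ... | true  | false = cong not (-≤ᵇ-smaller a b (ℕ.≤∧≢⇒< ∣a∣≤∣b∣ (entries-at-distance-differ (suc j) uniq a∈ b∈)))
        where
        i+K%K≡1 : (i + K) % K ≡ 1
        i+K%K≡1 = trans ([m+n]%n≡m%n i K) (pivotAbs-position a∈ (≡ᵇ-true⇒≡ ∣a∣≡ᵇm))
        ∣a∣≤∣b∣ : ∣ a ∣ ≤ ∣ b ∣
        ∣a∣≤∣b∣ = subst (_≤ ∣ b ∣) (sym (≡ᵇ-true⇒≡ ∣a∣≡ᵇm)) (pivotAbs-≤ (x ∷ w) b∈ i+K%K≡1)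
      ... | false | true  = cong not (≤ᵇ-smaller- a b (ℕ.≤∧≢⇒< ∣b∣≤∣a∣ (entries-at-distance-differ (suc j) uniq a∈ b∈ ∘ sym)))
        where
        i%K≡1 : i % K ≡ 1
        i%K≡1 = trans (sym ([m+n]%n≡m%n i K)) (pivotAbs-position b∈ (≡ᵇ-true⇒≡ ∣b∣≡ᵇm))
        ∣b∣≤∣a∣ : ∣ b ∣ ≤ ∣ a ∣
        ∣b∣≤∣a∣ = subst (_≤ ∣ a ∣) (sym (≡ᵇ-true⇒≡ ∣b∣≡ᵇm)) (pivotAbs-≤ (x ∷ w) a∈ i%K≡1)
      ... | false | false = refl

    desB-flipPivot : ∀ n {w} → w ∈ Bn n → desB K (flipPivot w) ≡ desB K w
    desB-flipPivot n {[]}    _  = refl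
    desB-flipPivot n {x ∷ w} w∈ = begin
      countᵇ descent (zip (+ 0 ∷ map f (x ∷ w)) (drop K (+ 0 ∷ map f (x ∷ w))))
        ≡⟨ cong (λ z → countᵇ descent (zip (z ∷ map f (x ∷ w)) (drop K (z ∷ map f (x ∷ w))))) (flipAbs-0 m) ⟨
      countᵇ descent (zip (map f (+ 0 ∷ x ∷ w)) (drop K (map f (+ 0 ∷ x ∷ w))))
        ≡⟨ cong (countᵇ descent) (zip-drop-map f K (+ 0 ∷ x ∷ w)) ⟩
      countᵇ descent (map (Product.map f f) P)
        ≡⟨ countᵇ-map descent (Product.map f f) P ⟩
      countᵇ (descent ∘ Product.map f f) P
        ≡⟨ countᵇ-cong _ _ (All-zip-drop _ K (+ 0 ∷ x ∷ w) (descent-flipAbs x w (Bn-∣∣-unique₀ n w∈))) ⟩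
      countᵇ descent P ∎
      where
      open ≡-Reasoning
      m = pivotAbs (x ∷ w)
      f = flipAbs m
      P = zip (+ 0 ∷ x ∷ w) (drop K (+ 0 ∷ x ∷ w))

    pivotAbs-∈ : ∀ x w → ∃[ y ] y ∈ x ∷ w × ∣ y ∣ ≡ pivotAbs (x ∷ w)
    pivotAbs-∈ x w with pivotAbs-attained x w
    ... | _ , _ , here refl  , () , _
    ... | _ , y , there i,y∈ , _  , ∣y∣≡m = y , ∈-enumerateFrom⁻ 1 i,y∈ , ∣y∣≡m

    negative-flipAbs : ∀ m x → ∣ x ∣ ≢ 0 → negative (flipAbs m x) ≡ (if ∣ x ∣ ≡ᵇ m then not (negative x) else negative x)
    negative-flipAbs m x ∣x∣≢0 with ∣ x ∣ ≡ᵇ m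
    ... | true  = negative-neg x ∣x∣≢0
    ... | false = refl

    inD-flipPivot : ∀ n {w} → w ∈ Bn n → 1 ≤ n → inD (flipPivot w) ≡ not (inD w)
    inD-flipPivot n {[]}    w∈ 1≤n = ⊥-elim (ℕ.<⇒≢ 1≤n (proj₁ (∈-Bn⁻ n w∈)))
    inD-flipPivot n {x ∷ w} w∈ 1≤n with _ , w⊆ , uniq ← ∈-Bn⁻ n w∈ | y , y∈ , ∣y∣≡m ← pivotAbs-∈ x w =
      trans (sym (not-involutive _)) (cong not (begin
        not (isEven N′)          ≡⟨ isEven-suc N′ ⟨
        isEven (suc N′)          ≡⟨ cong isEven (+-comm 1 N′) ⟩
        isEven (N′ + 1)          ≡⟨ cong isEven flip-count ⟩
        isEven (negs (x ∷ w) + 2 * c)   ≡⟨ isEven-+-2* (negs (x ∷ w)) c ⟩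
        isEven (negs (x ∷ w))    ∎))
      where
      open ≡-Reasoning
      m = pivotAbs (x ∷ w)
      N′ = negs (flipPivot (x ∷ w))
      c = countᵇ (λ z → (∣ z ∣ ≡ᵇ m) ∧ not (negative z)) (x ∷ w)
      pivot-once : countᵇ (λ z → ∣ z ∣ ≡ᵇ m) (x ∷ w) ≡ 1
      pivot-once = subst (λ k → countᵇ (λ z → ∣ z ∣ ≡ᵇ k) (x ∷ w) ≡ 1) ∣y∣≡m (countᵇ-unique-one ∣_∣ uniq y∈)
      flip-count : N′ + 1 ≡ negs (x ∷ w) + 2 * c
      flip-count = begin
        negs (flipPivot (x ∷ w)) + 1
          ≡⟨ cong₂ _+_ (countᵇ-map negative (flipAbs m) (x ∷ w)) (sym pivot-once) ⟩
        countᵇ (negative ∘ flipAbs m) (x ∷ w) + countᵇ (λ z → ∣ z ∣ ≡ᵇ m) (x ∷ w)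
          ≡⟨ countᵇ-flip _ _ negative (All.map (λ {z} z∈ → negative-flipAbs m z (signedVals-∣∣≢0 n z∈)) w⊆) ⟩
        negs (x ∷ w) + 2 * c ∎

  -- odd = false counts D_n, odd = true counts its complement.
  classCount : ℕ → ℕ → Bool → ℕ → ℕ
  classCount n k odd p = countᵇ (λ w → (odd xor inD w) ∧ (desB k w ≡ᵇ p)) (Bn n)

  ≡ᵇ-complements : ∀ {a a′ p p′ N} → a + a′ ≡ N → p + p′ ≡ N → (a ≡ᵇ p) ≡ (a′ ≡ᵇ p′)
  ≡ᵇ-complements {a} {a′} {p} {p′} a+a′≡N p+p′≡N = T-injective
    (λ t → ≡⇒≡ᵇ a′ p′ (ℕ.+-cancelˡ-≡ a a′ p′ (trans a+a′≡N (trans (sym p+p′≡N) (cong (_+ p′) (sym (≡ᵇ⇒≡ a p t)))))))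
    (λ t → ≡⇒≡ᵇ a p (ℕ.+-cancelʳ-≡ a′ a p (trans a+a′≡N (trans (sym p+p′≡N) (cong (λ z → p + z) (sym (≡ᵇ⇒≡ a′ p′ t)))))))

  map-neg-involutive : ∀ w → map -_ (map -_ w) ≡ w
  map-neg-involutive w = trans (sym (List.map-∘ w)) (trans (List.map-cong ℤ.neg-involutive w) (List.map-id w))

  map-neg-∣∣ : ∀ w → map ∣_∣ (map -_ w) ≡ map ∣_∣ w
  map-neg-∣∣ w = trans (sym (List.map-∘ w)) (List.map-cong ℤ.∣-i∣≡∣i∣ w)

  classCount-neg : ∀ n k odd {p q} → p + q ≡ n ∸ k →
    classCount n (suc k) odd p ≡ classCount n (suc k) (odd xor not (isEven n)) q
  classCount-neg n k odd {p} {q} p+q≡ = trans (countᵇ-Bn-involution n (map -_) map-neg-involutive map-neg-∣∣ _)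
    (countᵇ-cong _ _ (All.tabulate λ {w} w∈ → cong₂ _∧_
      (trans (cong (odd xor_) (inD-neg n w∈)) (sym (xor-assoc odd (not (isEven n)) (inD w))))
      (≡ᵇ-complements {desB (suc k) (map -_ w)} {desB (suc k) w} {p} {q} (desB-neg n k w∈) p+q≡)))

  classCount-flipPivot : ∀ n j odd p → 1 ≤ n → classCount n (2 + j) odd p ≡ classCount n (2 + j) (not odd) p
  classCount-flipPivot n j odd p 1≤n = trans (countᵇ-Bn-involution n flipPivot flipPivot-involutive flipPivot-∣∣ _)
    (countᵇ-cong _ _ (All.tabulate λ {w} w∈ → cong₂ _∧_
      (trans (cong (odd xor_) (inD-flipPivot n w∈ 1≤n)) (trans (sym (not-distribʳ-xor odd (inD w))) (not-distribˡ-xor odd (inD w))))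
      (cong (_≡ᵇ p) (desB-flipPivot n w∈))))
    where open PivotFlip j

  classCount-vanishes : ∀ n k odd {p} → n ∸ k < p → classCount n (suc k) odd p ≡ 0
  classCount-vanishes n k odd n∸k<p = countᵇ-none _ (All.tabulate λ {w} w∈ →
    trans (cong ((odd xor inD w) ∧_) (T-injective (λ t → ℕ.<⇒≢ (ℕ.≤-<-trans (desB-≤ n k w∈) n∸k<p) (≡ᵇ⇒≡ _ _ t)) λ ()))
          (∧-zeroʳ (odd xor inD w)))

  classCount-palindromic : ∀ n k odd {p q} → 1 ≤ n → n % 2 ≡ 0 ⊎ (n % 2 ≡ 1 × 2 ≤ suc k) → p + q ≡ n ∸ k →
    classCount n (suc k) odd p ≡ classCount n (suc k) odd q
  classCount-palindromic n k odd {p} {q} _ (inj₁ n-even) p+q≡ = begin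
    classCount n (suc k) odd p                          ≡⟨ classCount-neg n k odd p+q≡ ⟩
    classCount n (suc k) (odd xor not (isEven n)) q     ≡⟨ cong (λ e → classCount n (suc k) (odd xor not e) q) (cong (_≡ᵇ 0) n-even) ⟩
    classCount n (suc k) (odd xor false) q              ≡⟨ cong (λ o → classCount n (suc k) o q) (xor-identityʳ odd) ⟩
    classCount n (suc k) odd q                          ∎
    where open ≡-Reasoning
  classCount-palindromic n zero    odd _ (inj₂ (_ , ℕ.s≤s ())) _
  classCount-palindromic n (suc j) odd {p} {q} 1≤n (inj₂ (n-odd , _)) p+q≡ = begin
    classCount n (2 + j) odd p                          ≡⟨ classCount-neg n (suc j) odd p+q≡ ⟩
    classCount n (2 + j) (odd xor not (isEven n)) q     ≡⟨ cong (λ e → classCount n (2 + j) (odd xor not e) q) (cong (_≡ᵇ 0) n-odd) ⟩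
    classCount n (2 + j) (odd xor true) q               ≡⟨ cong (λ o → classCount n (2 + j) o q) (xor-comm odd true) ⟩
    classCount n (2 + j) (not odd) q                    ≡⟨ classCount-flipPivot n j (not odd) q 1≤n ⟩
    classCount n (2 + j) (not (not odd)) q              ≡⟨ cong (λ o → classCount n (2 + j) o q) (not-involutive odd) ⟩
    classCount n (2 + j) odd q                          ∎
    where open ≡-Reasoning

  classCount-complementary : ∀ n odd {p q} → n % 2 ≡ 1 → p + q ≡ n →
    classCount n 1 odd p ≡ classCount n 1 (not odd) q
  classCount-complementary n odd {p} {q} n-odd p+q≡n = begin
    classCount n 1 odd p                          ≡⟨ classCount-neg n 0 odd p+q≡n ⟩
    classCount n 1 (odd xor not (isEven n)) q     ≡⟨ cong (λ e → classCount n 1 (odd xor not e) q) (cong (_≡ᵇ 0) n-odd) ⟩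
    classCount n 1 (odd xor true) q               ≡⟨ cong (λ o → classCount n 1 o q) (xor-comm odd true) ⟩
    classCount n 1 (not odd) q                    ∎
    where open ≡-Reasoning

  -- The normalised counts δ and δ̄

  [+m]-[+n]≡+[m∸n] : ∀ {m n} → n ≤ m → + m -ℤ + n ≡ + (m ∸ n)
  [+m]-[+n]≡+[m∸n] {m} {n} n≤m = trans (ℤ.[+m]-[+n]≡m⊖n m n) (ℤ.⊖-≥ n≤m)

  [+m]-[+n]<0 : ∀ {m n} → m < n → ∃[ d ] + m -ℤ + n ≡ -[1+ d ]
  [+m]-[+n]<0 {m} {n} m<n with n ∸ m | ℕ.m<n⇒0<n∸m m<n | trans (ℤ.[+m]-[+n]≡m⊖n m n) (ℤ.⊖-< m<n)
  ... | suc d | _ | m-n≡-[1+d] = d , m-n≡-[1+d]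

  n-[1+k]+1≡n∸k : ∀ {n k} → suc k ≤ n → + n -ℤ + suc k +ℤ + 1 ≡ + (n ∸ k)
  n-[1+k]+1≡n∸k {n} {k} k<n = begin
    + n -ℤ + suc k +ℤ + 1     ≡⟨ cong (_+ℤ + 1) ([+m]-[+n]≡+[m∸n] k<n) ⟩
    + (n ∸ suc k + 1)         ≡⟨ cong +_ (+-comm (n ∸ suc k) 1) ⟩
    + suc (n ∸ suc k)         ≡⟨ cong +_ (ℕ.+-∸-assoc 1 k<n) ⟨
    + (n ∸ k)                 ∎
    where open ≡-Reasoning

  normalise-0 : ∀ n k → normalise n k 0 ≡ 0ℚ
  normalise-0 n zero          = refl
  normalise-0 n (suc zero)    = refl
  normalise-0 n (suc (suc k)) = ℚ.0/n≡0 (2 ^ e * n !) {{ℕ.m*n≢0 (2 ^ e) (n !) {{ℕ.m^n≢0 2 e}} {{n !≢0}}}}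
    where e = n ∸ (n ℕ./ suc (suc k)) ∸ 1

  δ-class : Bool → ℕ → ℕ → ℤ → ℚ
  δ-class false = δ
  δ-class true  = δ̄

  δ-class-+ : ∀ odd n k p → δ-class odd n k (+ p) ≡ normalise n k (classCount n k odd p)
  δ-class-+ false n k p = refl
  δ-class-+ true  n k p = refl

  δ-class-negative : ∀ odd n k d → δ-class odd n k -[1+ d ] ≡ 0ℚ
  δ-class-negative false n k d = refl
  δ-class-negative true  n k d = refl

  δ-class-reflect : ∀ odd odd′ n k M p →
    (∀ {q} → q ≤ M → classCount n k odd q ≡ classCount n k odd′ (M ∸ q)) →
    (∀ {q} → M < q → classCount n k odd q ≡ 0) →
    δ-class odd n k (+ p) ≡ δ-class odd′ n k (+ M -ℤ + p)
  δ-class-reflect odd odd′ n k M p reflect vanish with p ℕ.≤? M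
  ... | yes p≤M = begin
    δ-class odd n k (+ p)                           ≡⟨ δ-class-+ odd n k p ⟩
    normalise n k (classCount n k odd p)            ≡⟨ cong (normalise n k) (reflect p≤M) ⟩
    normalise n k (classCount n k odd′ (M ∸ p))     ≡⟨ δ-class-+ odd′ n k (M ∸ p) ⟨
    δ-class odd′ n k (+ (M ∸ p))                    ≡⟨ cong (δ-class odd′ n k) ([+m]-[+n]≡+[m∸n] p≤M) ⟨
    δ-class odd′ n k (+ M -ℤ + p)                   ∎
    where open ≡-Reasoning
  ... | no p≰M with M<p ← ℕ.≰⇒> p≰M with d , M-p≡-[1+d] ← [+m]-[+n]<0 M<p = begin
    δ-class odd n k (+ p)                           ≡⟨ δ-class-+ odd n k p ⟩
    normalise n k (classCount n k odd p)            ≡⟨ cong (normalise n k) (vanish M<p) ⟩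
    normalise n k 0                                 ≡⟨ normalise-0 n k ⟩
    0ℚ                                              ≡⟨ δ-class-negative odd′ n k d ⟨
    δ-class odd′ n k -[1+ d ]                       ≡⟨ cong (δ-class odd′ n k) M-p≡-[1+d] ⟨
    δ-class odd′ n k (+ M -ℤ + p)                   ∎
    where open ≡-Reasoning

  δ-class-palindromic : ∀ n k odd p → 1 ≤ n → suc k ≤ n → n % 2 ≡ 0 ⊎ (n % 2 ≡ 1 × 2 ≤ suc k) →
    δ-class odd n (suc k) (+ p) ≡ δ-class odd n (suc k) (+ n -ℤ + suc k +ℤ + 1 -ℤ + p)
  δ-class-palindromic n k odd p 1≤n k<n parity =
    subst (λ M → δ-class odd n (suc k) (+ p) ≡ δ-class odd n (suc k) (M -ℤ + p)) (sym (n-[1+k]+1≡n∸k k<n))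
      (δ-class-reflect odd odd n (suc k) (n ∸ k) p
        (λ q≤ → classCount-palindromic n k odd 1≤n parity (ℕ.m+[n∸m]≡n q≤))
        (classCount-vanishes n k odd))

  δ-class-complementary : ∀ n odd p → n % 2 ≡ 1 → δ-class odd n 1 (+ p) ≡ δ-class (not odd) n 1 (+ n -ℤ + p)
  δ-class-complementary n odd p n-odd = δ-class-reflect odd (not odd) n 1 n p
    (λ q≤n → classCount-complementary n odd n-odd (ℕ.m+[n∸m]≡n q≤n))
    (classCount-vanishes n 0 odd)

open import Defs
open import Data.Bool using (false; true)
open import Data.Nat using (ℕ; zero; suc; _≤_; _%_)
open import Data.Integer using (+_; _-_; _+_)
open import Data.Product using (_×_; _,_)
open import Data.Sum using (_⊎_)
open import Relation.Binary.PropositionalEquality using (_≡_)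
open DescentSymmetries using (δ-class-palindromic; δ-class-complementary)

proposition25 : ∀ (n k p : ℕ) → 1 ≤ n → 1 ≤ k → k ≤ n → p ≤ n →
    ((n % 2 ≡ 0 ⊎ (n % 2 ≡ 1 × 2 ≤ k)) →
       (δ n k (+ p) ≡ δ n k (+ n - + k + + 1 - + p))
       × (δ̄ n k (+ p) ≡ δ̄ n k (+ n - + k + + 1 - + p)))
    × ((n % 2 ≡ 1 × k ≡ 1) →
       (δ n 1 (+ p) ≡ δ̄ n 1 (+ n - + p))
       × (δ̄ n 1 (+ p) ≡ δ n 1 (+ n - + p)))
proposition25 n zero    p _   () _   _
proposition25 n (suc k) p 1≤n _  k<n _ =
  (λ parity → δ-class-palindromic n k false p 1≤n k<n parity , δ-class-palindromic n k true p 1≤n k<n parity) ,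
  (λ (n-odd , _) → δ-class-complementary n false p n-odd , δ-class-complementary n true p n-odd)
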